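{- For all integers $i,j\ge 0$: $\mu_{\rm t}(C_5^{(i,j)})=i+j$; $\mu_{\rm o}(C_5^{(i,j)})=\mu_{\rm d}(C_5^{(i,j)})=i+j+2$; and $\mu(C_5^{(i,j)})=i+j+3$.
   Context: Let $v_1v_2v_3v_4v_5v_1$ be a $5$-cycle. $C_5^{(i,j)}$ is the graph obtained from it by adding $i$ new vertices, each adjacent exactly to $v_2$ and $v_5$ (copies of $v_1$), and $j$ new vertices, each adjacent exactly to $v_2$ and $v_4$ (copies of $v_3$). For a connected graph $G$ and $X\subseteq V(G)$, two vertices are $X$-visible if there is a shortest path between them whose internal vertices are not in $X$. $X$ is: a mutual-visibility set if every two vertices of $X$ are $X$-visible; an outer mutual-visibility set if moreover every $x\in X$ and $y\notin X$ are $X$-visible; a dual mutual-visibility set if every two vertices of $X$ and every two vertices of $V(G)\setminus X$ are $X$-visible; a total mutual-visibility set if every two vertices of $G$ are $X$-visible. $\mu,\mu_{\rm o},\mu_{\rm d},\mu_{\rm t}$ denote the respective maximum cardinalities. -}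

module Defs where

open import Data.Nat using (ℕ; zero; suc; _+_; _≤_; _%_)
open import Data.Fin using (Fin; toℕ; splitAt)
open import Data.Fin.Subset using (Subset; _∈_; _∉_; ∣_∣)
open import Data.Product using (Σ; _×_; _,_)
open import Data.Sum using (_⊎_; inj₁; inj₂)
open import Data.Unit using (⊤)
open import Data.Empty using (⊥)
open import Relation.Binary.PropositionalEquality using (_≡_)

Graph : ℕ → Set₁
Graph n = Fin n → Fin n → Set

data Walk {n : ℕ} (G : Graph n) : Fin n → Fin n → Set where
  []  : {u : Fin n} → Walk G u u
  _∷_ : {u w v : Fin n} → G u w → Walk G w v → Walk G u v

length : {n : ℕ} {G : Graph n} {u v : Fin n} → Walk G u v → ℕ
length []      = 0
length (_ ∷ p) = suc (length p)

-- A shortest u,v-path: a walk whose length is at most that of every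
-- u,v-walk (such a walk is automatically a path).
IsShortest : {n : ℕ} {G : Graph n} {u v : Fin n} → Walk G u v → Set
IsShortest {G = G} {u} {v} p = (q : Walk G u v) → length p ≤ length q

InternalAvoid : {n : ℕ} {G : Graph n} {u v : Fin n} → Subset n → Walk G u v → Set
InternalAvoid X [] = ⊤
InternalAvoid X (_ ∷ []) = ⊤
InternalAvoid X (_∷_ {w = w} _ p@(_ ∷ _)) = (w ∉ X) × InternalAvoid X p

Visible : {n : ℕ} → Graph n → Subset n → Fin n → Fin n → Set
Visible G X u v = Σ (Walk G u v) λ p → IsShortest p × InternalAvoid X p

MutualVis : {n : ℕ} → Graph n → Subset n → Set
MutualVis G X = ∀ u v → u ∈ X → v ∈ X → Visible G X u v

OuterMutualVis : {n : ℕ} → Graph n → Subset n → Set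
OuterMutualVis G X =
  MutualVis G X × (∀ x y → x ∈ X → y ∉ X → Visible G X x y)

DualMutualVis : {n : ℕ} → Graph n → Subset n → Set
DualMutualVis G X =
  MutualVis G X × (∀ u v → u ∉ X → v ∉ X → Visible G X u v)

TotalMutualVis : {n : ℕ} → Graph n → Subset n → Set
TotalMutualVis G X = ∀ u v → Visible G X u v

IsMaxCard : {n : ℕ} → (Subset n → Set) → ℕ → Set
IsMaxCard {n} P k =
  (Σ (Subset n) λ X → P X × ∣ X ∣ ≡ k) × (∀ X → P X → ∣ X ∣ ≤ k)

-- Vertices 0..4 are v1..v5 of the cycle (vertex a ↦ v_{a+1});
-- the next i vertices are the copies of v1 (adjacent to v2, v5);
-- the last j vertices are the copies of v3 (adjacent to v2, v4).

data Kind : Set where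
  cyc  : Fin 5 → Kind
  cp1  : Kind
  cp3  : Kind

kind : (i j : ℕ) → Fin (5 + (i + j)) → Kind
kind i j x with splitAt 5 x
... | inj₁ a = cyc a
... | inj₂ y with splitAt i y
...   | inj₁ _ = cp1
...   | inj₂ _ = cp3

KAdj : Kind → Kind → Set
KAdj (cyc a) (cyc b) = (toℕ b ≡ (toℕ a + 1) % 5) ⊎ (toℕ a ≡ (toℕ b + 1) % 5)
KAdj (cyc a) cp1 = (toℕ a ≡ 1) ⊎ (toℕ a ≡ 4)
KAdj (cyc a) cp3 = (toℕ a ≡ 1) ⊎ (toℕ a ≡ 3)
KAdj cp1 (cyc b) = (toℕ b ≡ 1) ⊎ (toℕ b ≡ 4)
KAdj cp3 (cyc b) = (toℕ b ≡ 1) ⊎ (toℕ b ≡ 3)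
KAdj cp1 cp1 = ⊥
KAdj cp1 cp3 = ⊥
KAdj cp3 cp1 = ⊥
KAdj cp3 cp3 = ⊥

C5 : (i j : ℕ) → Graph (5 + (i + j))
C5 i j x y = KAdj (kind i j x) (kind i j y)

-- Every vertex of C5^(i,j) is a copy of one of v₁, …, v₅, and adjacency only depends on
-- which ones.  Two cycle vertices at distance two are joined by shortest paths only through
-- copies of the vertex between them, so whenever a visibility notion requires them to see
-- each other, that class has a vertex outside X.  Running through the 32 traces of X on the
-- cycle, this leaves at least 5, 3, 3 and 2 classes with a vertex outside X for total, outer,
-- dual and plain mutual visibility, and ∣ X ∣ is at most 5 + i + j minus that number.  The
-- bounds are attained by all copies together with ∅, {v₁, v₃}, {v₁, v₅} and {v₁, v₃, v₄}.
module Submission where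

open import Defs
open import Data.Nat using (ℕ; _+_)
open import Data.Product using (_×_)

open import Data.Nat using (zero; suc; _≤_; _≤?_; z≤n; s≤s; _%_)
open import Data.Nat.Properties
  using (_≟_; +-commutativeSemigroup; +-suc; +-comm; +-monoʳ-≤; +-cancelʳ-≤; ≤-trans; ≤-refl; n≤1+n)
open import Data.Bool using (Bool; true; false; not; _∧_; _∨_; _xor_; T)
open import Data.Bool.Properties using (T?; T-≡; T-∨) renaming (_≟_ to _≟ᵇ_)
open import Data.Empty using (⊥)
open import Data.Fin using (Fin; zero; suc; toℕ; splitAt; _↑ˡ_; _↑ʳ_)
open import Data.Fin.Patterns using (0F; 1F; 2F; 3F; 4F)
open import Data.Fin.Properties using (all?; any?; ↑ˡ-injective; splitAt-↑ˡ; splitAt⁻¹-↑ˡ)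
  renaming (_≟_ to _≟ᶠ_)
open import Data.Fin.Subset using (Subset; _∈_; _∉_; ∣_∣; inside; outside; Empty; ⊤)
open import Data.Fin.Subset.Properties using (Empty-unique; ∣⊥∣≡0; ∣⊤∣≡n; anySubset?)
open import Data.Vec using (_∷_; []; _++_; lookup; tabulate; _[_]≔_; here; there)
open import Data.Vec.Properties
  using ([]=⇒lookup; lookup⇒[]=; lookup∘tabulate; tabulate-cong; tabulate∘lookup; lookup-replicate)
open import Data.Product using (_,_; ∃-syntax)
open import Data.Sum using (_⊎_; inj₁; inj₂; swap)
import Data.Sum as Sum
open import Data.Unit using (tt)
open import Function using (_∘_; id; _⇔_; mk⇔; Equivalence)
open import Relation.Nullary using (¬_; Dec; yes; no; contradiction)
open import Relation.Nullary.Decidable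
  using (from-yes; map′; decidable-stable; ¬?; _×-dec_; _⊎-dec_; _→-dec_)
open import Relation.Nullary.Reflects using (Reflects; ofʸ; ofⁿ; fromEquivalence; det)
open import Relation.Binary.PropositionalEquality
  using (_≡_; _≢_; refl; sym; trans; cong; subst; subst₂)

open Equivalence using (to; from)
open import Algebra.Properties.CommutativeSemigroup +-commutativeSemigroup using (xy∙z≈xz∙y)

∈-remove⁻ : ∀ {k} {c d : Fin k} (M : Subset k) → c ∈ M [ d ]≔ outside → c ∈ M × c ≢ d
∈-remove⁻ {c = zero}  {zero}  (_ ∷ M) ()
∈-remove⁻ {c = zero}  {suc d} (_ ∷ M) here      = here , λ ()
∈-remove⁻ {c = suc c} {zero}  (_ ∷ M) (there p) = there p , λ ()
∈-remove⁻ {c = suc c} {suc d} (_ ∷ M) (there p) with ∈-remove⁻ M p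
... | c∈M , c≢d = there c∈M , λ { refl → c≢d refl }

∣p∣≤1+∣p[x]≔outside∣ : ∀ {k} (M : Subset k) (d : Fin k) → ∣ M ∣ ≤ suc ∣ M [ d ]≔ outside ∣
∣p∣≤1+∣p[x]≔outside∣ (true  ∷ M) zero    = ≤-refl
∣p∣≤1+∣p[x]≔outside∣ (false ∷ M) zero    = n≤1+n _
∣p∣≤1+∣p[x]≔outside∣ (true  ∷ M) (suc d) = s≤s (∣p∣≤1+∣p[x]≔outside∣ M d)
∣p∣≤1+∣p[x]≔outside∣ (false ∷ M) (suc d) = ∣p∣≤1+∣p[x]≔outside∣ M d

∣p++q∣≡∣p∣+∣q∣ : ∀ {m k} (p : Subset m) (q : Subset k) → ∣ p ++ q ∣ ≡ ∣ p ∣ + ∣ q ∣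
∣p++q∣≡∣p∣+∣q∣ []          q = refl
∣p++q∣≡∣p∣+∣q∣ (true  ∷ p) q = cong suc (∣p++q∣≡∣p∣+∣q∣ p q)
∣p++q∣≡∣p∣+∣q∣ (false ∷ p) q = ∣p++q∣≡∣p∣+∣q∣ p q

∈-reflects : ∀ {n} (X : Subset n) u → Reflects (u ∈ X) (lookup X u)
∈-reflects X u =
  fromEquivalence (λ t → lookup⇒[]= u X (to T-≡ t)) (λ u∈X → from T-≡ ([]=⇒lookup u∈X))

∈-tabulate⁻ : ∀ {n} {f : Fin n → Bool} {u} → u ∈ tabulate f → T (f u)
∈-tabulate⁻ {f = f} {u} u∈ = from T-≡ (trans (sym (lookup∘tabulate f u)) ([]=⇒lookup u∈))

Missed : ∀ {n k} → Subset n → (Fin n → Fin k) → Fin k → Set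
Missed X κ c = ∃[ w ] w ∉ X × κ w ≡ c

∣X∣+∣M∣≤n : ∀ {n k} (κ : Fin n → Fin k) (X : Subset n) (M : Subset k) →
            (∀ c → c ∈ M → Missed X κ c) → ∣ X ∣ + ∣ M ∣ ≤ n
∣X∣+∣M∣≤n {k = k} κ [] M missed =
  subst (_≤ 0) (sym (trans (cong ∣_∣ (Empty-unique noMember)) (∣⊥∣≡0 k))) z≤n
  where
  noMember : Empty M
  noMember (c , c∈M) with missed c c∈M
  ... | () , _
∣X∣+∣M∣≤n κ (true ∷ X) M missed = s≤s (∣X∣+∣M∣≤n (κ ∘ suc) X M missed′)
  where
  missed′ : ∀ c → c ∈ M → Missed X (κ ∘ suc) c
  missed′ c c∈M with missed c c∈M
  ... | zero  , w∉ , _  = contradiction here w∉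
  ... | suc w , w∉ , eq = w , w∉ ∘ there , eq
∣X∣+∣M∣≤n {suc n} κ (false ∷ X) M missed =
  ≤-trans (+-monoʳ-≤ ∣ X ∣ (∣p∣≤1+∣p[x]≔outside∣ M (κ zero)))
          (subst (_≤ suc n) (sym (+-suc ∣ X ∣ ∣ M′ ∣)) (s≤s (∣X∣+∣M∣≤n (κ ∘ suc) X M′ missed′)))
  where
  -- the vertex 0 ∉ X can only serve the class κ 0, so that class is set aside
  M′ = M [ κ zero ]≔ outside
  missed′ : ∀ c → c ∈ M′ → Missed X (κ ∘ suc) c
  missed′ c c∈M′ with ∈-remove⁻ M c∈M′
  ... | c∈M , c≢κ0 with missed c c∈M
  ...   | zero  , _  , eq = contradiction (sym eq) c≢κ0
  ...   | suc w , w∉ , eq = w , w∉ ∘ there , eq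

allSubsets? : ∀ {n} {P : Subset n → Set} → (∀ S → Dec (P S)) → Dec (∀ S → P S)
allSubsets? P? =
  map′ (λ noCounterexample S → decidable-stable (P? S) (λ ¬PS → noCounterexample (S , ¬PS)))
       (λ all (S , ¬PS) → ¬PS (all S))
       (¬? (anySubset? (¬? ∘ P?)))

¬-reflects : ∀ {A : Set} {b} → Reflects A b → T (not b) → ¬ A
¬-reflects (ofⁿ ¬a) _ = ¬a

module _ {n : ℕ} {G : Graph n} {X : Subset n} where

  visible-refl : ∀ {u} → Visible G X u u
  visible-refl = [] , (λ _ → z≤n) , tt

  visible-edge : ∀ {u w} → u ≢ w → G u w → Visible G X u w
  visible-edge u≢w uw = (uw ∷ []) , shortest , tt
    where
    shortest : ∀ q → 1 ≤ length q
    shortest []      = contradiction refl u≢w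
    shortest (_ ∷ _) = s≤s z≤n

  visible-via : ∀ {u w} x → u ≢ w → ¬ G u w → G u x → G x w → x ∉ X → Visible G X u w
  visible-via x u≢w ¬uw ux xw x∉X = (ux ∷ xw ∷ []) , shortest , x∉X , tt
    where
    shortest : ∀ q → 2 ≤ length q
    shortest []           = contradiction refl u≢w
    shortest (uw ∷ [])    = contradiction uw ¬uw
    shortest (_ ∷ _ ∷ _)  = s≤s (s≤s z≤n)

  visible⇒via : ∀ {u w} x → u ≢ w → ¬ G u w → G u x → G x w →
                Visible G X u w → ∃[ y ] y ∉ X × G u y × G y w
  visible⇒via x u≢w ¬uw ux xw ([] , _)                       = contradiction refl u≢w
  visible⇒via x u≢w ¬uw ux xw ((uw ∷ []) , _)                = contradiction uw ¬uw
  visible⇒via x u≢w ¬uw ux xw ((uy ∷ yw ∷ []) , _ , y∉X , _) = _ , y∉X , uy , yw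
  visible⇒via x u≢w ¬uw ux xw ((_ ∷ _ ∷ _ ∷ _) , shortest , _) with shortest (ux ∷ xw ∷ [])
  ... | s≤s (s≤s ())

-- Each notion of mutual visibility asks, depending on whether u ∈ X and
-- w ∈ X, for some pairs (u , w) to be X-visible.
VisibleWhen : ∀ {n} → (Bool → Bool → Bool) → Graph n → Subset n → Set
VisibleWhen {n} r G X =
  ∀ (u w : Fin n) {a b} → Reflects (u ∈ X) a → Reflects (w ∈ X) b → T (r a b) → Visible G X u w

everyPair bothIn firstIn sameSide : Bool → Bool → Bool
everyPair _ _ = true
bothIn        = _∧_
firstIn a _   = a
sameSide a b  = not (a xor b)

module _ {n : ℕ} {G : Graph n} {X : Subset n} where

  total⇔everyPair : TotalMutualVis G X ⇔ VisibleWhen everyPair G X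
  total⇔everyPair = mk⇔ (λ h u w {_} {_} _ _ _ → h u w) (λ h u w → h u w (∈-reflects X u) (∈-reflects X w) tt)

  mutual⇔bothIn : MutualVis G X ⇔ VisibleWhen bothIn G X
  mutual⇔bothIn = mk⇔ to′ (λ h u w u∈ w∈ → h u w (ofʸ u∈) (ofʸ w∈) tt)
    where
    to′ : MutualVis G X → VisibleWhen bothIn G X
    to′ h u w (ofʸ u∈) (ofʸ w∈) _ = h u w u∈ w∈
    to′ h u w (ofʸ _)  (ofⁿ _)  ()
    to′ h u w (ofⁿ _)  _        ()

  outer⇔firstIn : OuterMutualVis G X ⇔ VisibleWhen firstIn G X
  outer⇔firstIn = mk⇔ to′ (λ h → (λ u w u∈ w∈ → h u w (ofʸ u∈) (ofʸ w∈) tt)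
                                , (λ u w u∈ w∉ → h u w (ofʸ u∈) (ofⁿ w∉) tt))
    where
    to′ : OuterMutualVis G X → VisibleWhen firstIn G X
    to′ (hm , ho) u w (ofʸ u∈) (ofʸ w∈) _ = hm u w u∈ w∈
    to′ (hm , ho) u w (ofʸ u∈) (ofⁿ w∉) _ = ho u w u∈ w∉
    to′ _         u w (ofⁿ _)  _        ()

  dual⇔sameSide : DualMutualVis G X ⇔ VisibleWhen sameSide G X
  dual⇔sameSide = mk⇔ to′ (λ h → (λ u w u∈ w∈ → h u w (ofʸ u∈) (ofʸ w∈) tt)
                                , (λ u w u∉ w∉ → h u w (ofⁿ u∉) (ofⁿ w∉) tt))
    where
    to′ : DualMutualVis G X → VisibleWhen sameSide G X
    to′ (hm , hd) u w (ofʸ u∈) (ofʸ w∈) _ = hm u w u∈ w∈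
    to′ (hm , hd) u w (ofⁿ u∉) (ofⁿ w∉) _ = hd u w u∉ w∉
    to′ _         u w (ofʸ _)  (ofⁿ _)  ()
    to′ _         u w (ofⁿ _)  (ofʸ _)  ()

kadj? : ∀ k l → Dec (KAdj k l)
kadj? (cyc a) (cyc b) = (toℕ b ≟ (toℕ a + 1) % 5) ⊎-dec (toℕ a ≟ (toℕ b + 1) % 5)
kadj? (cyc a) cp1     = (toℕ a ≟ 1) ⊎-dec (toℕ a ≟ 4)
kadj? (cyc a) cp3     = (toℕ a ≟ 1) ⊎-dec (toℕ a ≟ 3)
kadj? cp1     (cyc b) = (toℕ b ≟ 1) ⊎-dec (toℕ b ≟ 4)
kadj? cp3     (cyc b) = (toℕ b ≟ 1) ⊎-dec (toℕ b ≟ 3)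
kadj? cp1     cp1     = no λ ()
kadj? cp1     cp3     = no λ ()
kadj? cp3     cp1     = no λ ()
kadj? cp3     cp3     = no λ ()

KAdj-sym : ∀ k l → KAdj k l → KAdj l k
KAdj-sym (cyc _) (cyc _) = swap
KAdj-sym (cyc _) cp1     = id
KAdj-sym (cyc _) cp3     = id
KAdj-sym cp1     (cyc _) = id
KAdj-sym cp3     (cyc _) = id
KAdj-sym cp1     cp1     ()
KAdj-sym cp1     cp3     ()
KAdj-sym cp3     cp1     ()
KAdj-sym cp3     cp3     ()

allKinds? : {P : Kind → Set} → (∀ k → Dec (P k)) → Dec (∀ k → P k)
allKinds? P? =
  map′ (λ { (pc , p1 , p3) → λ { (cyc a) → pc a ; cp1 → p1 ; cp3 → p3 } })
       (λ all → all ∘ cyc , all cp1 , all cp3)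
       (all? (P? ∘ cyc) ×-dec P? cp1 ×-dec P? cp3)

cycleVertex : Kind → Fin 5
cycleVertex (cyc a) = a
cycleVertex cp1     = 0F
cycleVertex cp3     = 2F

prev next : Fin 5 → Fin 5
prev 0F = 4F
prev 1F = 0F
prev 2F = 1F
prev 3F = 2F
prev 4F = 3F
next 0F = 1F
next 1F = 2F
next 2F = 3F
next 3F = 4F
next 4F = 0F

prev≢next : ∀ c → prev c ≢ next c
prev≢next = from-yes (all? λ c → ¬? (prev c ≟ᶠ next c))

prev-adj : ∀ c → KAdj (cyc (prev c)) (cyc c)
prev-adj = from-yes (all? λ c → kadj? (cyc (prev c)) (cyc c))

adj-next : ∀ c → KAdj (cyc c) (cyc (next c))
adj-next = from-yes (all? λ c → kadj? (cyc c) (cyc (next c)))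

prev-nonadj-next : ∀ c → ¬ KAdj (cyc (prev c)) (cyc (next c))
prev-nonadj-next = from-yes (all? λ c → ¬? (kadj? (cyc (prev c)) (cyc (next c))))

common-neighbour : ∀ c k → KAdj (cyc (prev c)) k → KAdj k (cyc (next c)) → cycleVertex k ≡ c
common-neighbour = from-yes (all? λ c → allKinds? λ k →
  kadj? (cyc (prev c)) k →-dec (kadj? k (cyc (next c)) →-dec (cycleVertex k ≟ᶠ c)))

SameCycleVertex : Kind → Kind → Set
SameCycleVertex (cyc a) (cyc b) = a ≡ b
SameCycleVertex (cyc _) cp1     = ⊥
SameCycleVertex (cyc _) cp3     = ⊥
SameCycleVertex cp1     _       = ⊥
SameCycleVertex cp3     _       = ⊥

sameCycleVertex? : ∀ k l → Dec (SameCycleVertex k l)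
sameCycleVertex? (cyc a) (cyc b) = a ≟ᶠ b
sameCycleVertex? (cyc _) cp1     = no id
sameCycleVertex? (cyc _) cp3     = no id
sameCycleVertex? cp1     _       = no id
sameCycleVertex? cp3     _       = no id

-- Why a vertex of kind k sees one of kind l when membership in X is decided by kind.
Reach : (Kind → Bool) → Kind → Kind → Set
Reach memb k l =
  SameCycleVertex k l ⊎ KAdj k l ⊎ ∃[ m ] KAdj k (cyc m) × KAdj (cyc m) l × memb (cyc m) ≡ false

reach? : ∀ memb k l → Dec (Reach memb k l)
reach? memb k l = sameCycleVertex? k l ⊎-dec kadj? k l ⊎-dec
  any? (λ m → kadj? k (cyc m) ×-dec kadj? (cyc m) l ×-dec (memb (cyc m) ≟ᵇ false))

withCopies : Subset 5 → Kind → Bool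
withCopies S (cyc a) = lookup S a
withCopies S cp1     = true
withCopies S cp3     = true

KindVisible : (Bool → Bool → Bool) → (Kind → Bool) → Set
KindVisible r memb = ∀ k l → T (r (memb k) (memb l)) → Reach memb k l

kindVisible? : ∀ r memb → Dec (KindVisible r memb)
kindVisible? r memb = allKinds? λ k → allKinds? λ l → T? (r (memb k) (memb l)) →-dec reach? memb k l

-- The cycle vertices, v₁ = 0F, …, v₅ = 4F, of the extremal sets.
totalCycle outerCycle dualCycle mutualCycle : Subset 5
totalCycle  = outside ∷ outside ∷ outside ∷ outside ∷ outside ∷ []
outerCycle  = inside  ∷ outside ∷ inside  ∷ outside ∷ outside ∷ []
dualCycle   = inside  ∷ outside ∷ outside ∷ outside ∷ inside  ∷ []
mutualCycle = inside  ∷ outside ∷ inside  ∷ inside  ∷ outside ∷ []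

kindVisible-total : KindVisible everyPair (withCopies totalCycle)
kindVisible-total = from-yes (kindVisible? everyPair (withCopies totalCycle))

kindVisible-outer : KindVisible firstIn (withCopies outerCycle)
kindVisible-outer = from-yes (kindVisible? firstIn (withCopies outerCycle))

kindVisible-dual : KindVisible sameSide (withCopies dualCycle)
kindVisible-dual = from-yes (kindVisible? sameSide (withCopies dualCycle))

kindVisible-mutual : KindVisible bothIn (withCopies mutualCycle)
kindVisible-mutual = from-yes (kindVisible? bothIn (withCopies mutualCycle))

-- For S the cycle vertices in X, class c must have a vertex outside X when
-- v_c ∉ X, or when the rule requires the neighbours of v_c on the cycle to
-- see each other: only a vertex of class c lies between them.
isForced : (Bool → Bool → Bool) → (Fin 5 → Bool) → Fin 5 → Bool
isForced r s c = not (s c) ∨ r (s (prev c)) (s (next c)) ∨ r (s (next c)) (s (prev c))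

forced : (Bool → Bool → Bool) → Subset 5 → Subset 5
forced r S = tabulate (isForced r (lookup S))

forced-everyPair : ∀ S → 5 ≤ ∣ forced everyPair S ∣
forced-everyPair = from-yes (allSubsets? λ S → 5 ≤? ∣ forced everyPair S ∣)

forced-firstIn : ∀ S → 3 ≤ ∣ forced firstIn S ∣
forced-firstIn = from-yes (allSubsets? λ S → 3 ≤? ∣ forced firstIn S ∣)

forced-sameSide : ∀ S → 3 ≤ ∣ forced sameSide S ∣
forced-sameSide = from-yes (allSubsets? λ S → 3 ≤? ∣ forced sameSide S ∣)

forced-bothIn : ∀ S → 2 ≤ ∣ forced bothIn S ∣
forced-bothIn = from-yes (allSubsets? λ S → 2 ≤? ∣ forced bothIn S ∣)

module _ (i j : ℕ) where

  v : Fin 5 → Fin (5 + (i + j))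
  v c = c ↑ˡ (i + j)

  kind-v : ∀ c → kind i j (v c) ≡ cyc c
  kind-v c rewrite splitAt-↑ˡ 5 c (i + j) = refl

  kind≡cyc⇒v : ∀ u {a} → kind i j u ≡ cyc a → v a ≡ u
  kind≡cyc⇒v u eq with splitAt 5 u in split
  ... | inj₁ _ with refl ← eq = splitAt⁻¹-↑ˡ split
  ... | inj₂ y with splitAt i y
  ...   | inj₁ _ with () ← eq
  ...   | inj₂ _ with () ← eq

  sameCycleVertex⇒≡ : ∀ u w → SameCycleVertex (kind i j u) (kind i j w) → u ≡ w
  sameCycleVertex⇒≡ u w same with kind i j u in ku | kind i j w in kw
  ... | cyc a | cyc b = trans (sym (kind≡cyc⇒v u ku)) (trans (cong v same) (kind≡cyc⇒v w kw))

  v-adj : ∀ a y → C5 i j (v a) y ⇔ KAdj (cyc a) (kind i j y)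
  v-adj a y = mk⇔ (subst (λ k → KAdj k (kind i j y)) (kind-v a))
                  (subst (λ k → KAdj k (kind i j y)) (sym (kind-v a)))

  adj-v : ∀ y a → C5 i j y (v a) ⇔ KAdj (kind i j y) (cyc a)
  adj-v y a = mk⇔ (subst (KAdj (kind i j y)) (kind-v a))
                  (subst (KAdj (kind i j y)) (sym (kind-v a)))

  cycle-edge : ∀ a b → C5 i j (v a) (v b) ⇔ KAdj (cyc a) (cyc b)
  cycle-edge a b = mk⇔ (subst₂ KAdj (kind-v a) (kind-v b))
                       (subst₂ KAdj (sym (kind-v a)) (sym (kind-v b)))

  missed-between : ∀ {X} c →
                   Visible (C5 i j) X (v (prev c)) (v (next c)) ⊎ Visible (C5 i j) X (v (next c)) (v (prev c)) →
                   Missed X (cycleVertex ∘ kind i j) c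
  missed-between c (inj₁ vis)
    with visible⇒via (v c) (prev≢next c ∘ ↑ˡ-injective (i + j) _ _)
                     (prev-nonadj-next c ∘ to (cycle-edge (prev c) (next c)))
                     (from (cycle-edge (prev c) c) (prev-adj c))
                     (from (cycle-edge c (next c)) (adj-next c)) vis
  ... | y , y∉X , py , yn =
    y , y∉X , common-neighbour c (kind i j y) (to (v-adj (prev c) y) py) (to (adj-v y (next c)) yn)
  missed-between c (inj₂ vis)
    with visible⇒via (v c) (prev≢next c ∘ sym ∘ ↑ˡ-injective (i + j) _ _)
                     (prev-nonadj-next c ∘ KAdj-sym (cyc (next c)) (cyc (prev c)) ∘ to (cycle-edge (next c) (prev c)))
                     (from (cycle-edge (next c) c) (KAdj-sym (cyc c) (cyc (next c)) (adj-next c)))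
                     (from (cycle-edge c (prev c)) (KAdj-sym (cyc (prev c)) (cyc c) (prev-adj c))) vis
  ... | y , y∉X , ny , yp =
    y , y∉X , common-neighbour c (kind i j y) (KAdj-sym _ _ (to (adj-v y (prev c)) yp))
                                              (KAdj-sym _ _ (to (v-adj (next c) y) ny))

  onCycle : Subset (5 + (i + j)) → Subset 5
  onCycle X = tabulate (lookup X ∘ v)

  onCycle-reflects : ∀ X a → Reflects (v a ∈ X) (lookup (onCycle X) a)
  onCycle-reflects X a = subst (Reflects _) (sym (lookup∘tabulate (lookup X ∘ v) a)) (∈-reflects X (v a))

  forced-missed : ∀ {r X} → VisibleWhen r (C5 i j) X →
                  ∀ c → c ∈ forced r (onCycle X) → Missed X (cycleVertex ∘ kind i j) c
  forced-missed {r} {X} vis c c∈ with to T-∨ (∈-tabulate⁻ {f = isForced r (lookup (onCycle X))} c∈)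
  ... | inj₁ vc∉ = v c , ¬-reflects (onCycle-reflects X c) vc∉ , cong cycleVertex (kind-v c)
  ... | inj₂ sees = missed-between c (Sum.map (vis _ _ (onCycle-reflects X _) (onCycle-reflects X _))
                                              (vis _ _ (onCycle-reflects X _) (onCycle-reflects X _))
                                              (to T-∨ sees))

  upper-bound : ∀ r t → (∀ S → t ≤ ∣ forced r S ∣) → ∀ X → VisibleWhen r (C5 i j) X → ∣ X ∣ + t ≤ 5 + (i + j)
  upper-bound r t enough X vis =
    ≤-trans (+-monoʳ-≤ ∣ X ∣ (enough (onCycle X)))
            (∣X∣+∣M∣≤n (cycleVertex ∘ kind i j) X (forced r (onCycle X)) (forced-missed vis))

  byKind : (Kind → Bool) → Subset (5 + (i + j))
  byKind memb = tabulate (memb ∘ kind i j)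

  byKind-reflects : ∀ memb u → Reflects (u ∈ byKind memb) (memb (kind i j u))
  byKind-reflects memb u = subst (Reflects _) (lookup∘tabulate (memb ∘ kind i j) u) (∈-reflects (byKind memb) u)

  byKind-visible : ∀ {r memb} → KindVisible r memb → VisibleWhen r (C5 i j) (byKind memb)
  byKind-visible {r} {memb} kindVisible u w ru rw t with u ≟ᶠ w
  ... | yes refl = visible-refl
  ... | no u≢w
    with kindVisible (kind i j u) (kind i j w)
           (subst₂ (λ a b → T (r a b)) (det ru (byKind-reflects memb u)) (det rw (byKind-reflects memb w)) t)
  ...   | inj₁ same       = contradiction (sameCycleVertex⇒≡ u w same) u≢w
  ...   | inj₂ (inj₁ uw)  = visible-edge u≢w uw
  ...   | inj₂ (inj₂ (m , um , mw , m∉))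
    with kadj? (kind i j u) (kind i j w)
  ...     | yes uw = visible-edge u≢w uw
  ...     | no ¬uw = visible-via (v m) u≢w ¬uw (from (adj-v u m) um) (from (v-adj m w) mw)
                       (¬-reflects (byKind-reflects memb (v m)) (subst (T ∘ not) (sym m∉′) tt))
    where
    m∉′ : memb (kind i j (v m)) ≡ false
    m∉′ = trans (cong memb (kind-v m)) m∉

  ∣copies∣ : ∀ S → ∣ tabulate (λ y → withCopies S (kind i j (5 ↑ʳ y))) ∣ ≡ i + j
  ∣copies∣ S = trans (cong ∣_∣ (trans (tabulate-cong allIn) (tabulate∘lookup ⊤))) (∣⊤∣≡n (i + j))
    where
    allIn : ∀ y → withCopies S (kind i j (5 ↑ʳ y)) ≡ lookup ⊤ y
    allIn y with splitAt i y
    ... | inj₁ _ = sym (lookup-replicate y inside)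
    ... | inj₂ _ = sym (lookup-replicate y inside)

  ∣byKind-withCopies∣ : ∀ S → ∣ byKind (withCopies S) ∣ ≡ ∣ S ∣ + (i + j)
  ∣byKind-withCopies∣ S@(_ ∷ _ ∷ _ ∷ _ ∷ _ ∷ []) =
    trans (∣p++q∣≡∣p∣+∣q∣ S (tabulate (λ y → withCopies S (kind i j (5 ↑ʳ y)))))
          (cong (∣ S ∣ +_) (∣copies∣ S))

  maxCard : ∀ {P : Subset (5 + (i + j)) → Set} {r} S t {k} →
            (∀ {X} → P X ⇔ VisibleWhen r (C5 i j) X) →
            KindVisible r (withCopies S) → (∀ S′ → t ≤ ∣ forced r S′ ∣) →
            ∣ S ∣ + t ≡ 5 → ∣ S ∣ + (i + j) ≡ k → IsMaxCard P k
  maxCard {r = r} S t P⇔ kindVisible enough ∣S∣+t≡5 refl =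
      (byKind (withCopies S) , from P⇔ (byKind-visible kindVisible) , ∣byKind-withCopies∣ S)
    , λ X PX → +-cancelʳ-≤ t ∣ X ∣ (∣ S ∣ + (i + j))
                 (subst (∣ X ∣ + t ≤_) (size≡ ∣S∣+t≡5) (upper-bound r t enough X (to P⇔ PX)))
    where
    size≡ : ∣ S ∣ + t ≡ 5 → 5 + (i + j) ≡ ∣ S ∣ + (i + j) + t
    size≡ e = trans (cong (_+ (i + j)) (sym e)) (xy∙z≈xz∙y ∣ S ∣ t (i + j))

proposition5p4 : (i j : ℕ) →
    IsMaxCard (TotalMutualVis (C5 i j)) (i + j)
    × IsMaxCard (OuterMutualVis (C5 i j)) (i + j + 2)
    × IsMaxCard (DualMutualVis (C5 i j)) (i + j + 2)
    × IsMaxCard (MutualVis (C5 i j)) (i + j + 3)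
proposition5p4 i j =
    maxCard i j totalCycle  5 total⇔everyPair kindVisible-total  forced-everyPair refl refl
  , maxCard i j outerCycle  3 outer⇔firstIn   kindVisible-outer  forced-firstIn   refl (+-comm 2 (i + j))
  , maxCard i j dualCycle   3 dual⇔sameSide   kindVisible-dual   forced-sameSide  refl (+-comm 2 (i + j))
  , maxCard i j mutualCycle 2 mutual⇔bothIn   kindVisible-mutual forced-bothIn    refl (+-comm 3 (i + j))
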